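{- Let $\Delta$ be a pure simplicial complex on vertex set $[n]=\{1,\dots,n\}$ of codimension $c = n-\dim\Delta-1$. If $\Delta$ has at least $\binom{n}{c}-2c+1$ facets, then $\Delta$ is vertex decomposable.
   Context: A simplicial complex on vertex set $[n]$ is assumed to contain $\{i\}$ as a face for every $i\in[n]$. $\Delta$ is pure if all facets (maximal faces) have the same cardinality; $\dim F=|F|-1$ and $\dim\Delta=\max\{\dim F: F\in\Delta\}$. For a vertex $x$, $\mathrm{link}_\Delta(x)=\{G\in\Delta : x\notin G,\ G\cup\{x\}\in\Delta\}$ and $\mathrm{del}_\Delta(x)=\{G\in\Delta: x\notin G\}$. A vertex $x$ is a shedding vertex if for every facet $F$ of $\Delta$ with $x\in F$ there is a vertex $y\notin F$ such that $(F\setminus\{x\})\cup\{y\}\in\Delta$ (equivalently, every facet of $\mathrm{del}_\Delta(x)$ is a facet of $\Delta$). A simplicial complex $\Delta$ is vertex decomposable if either $\Delta=\{\emptyset\}$ or $\Delta$ is a simplex (has a single facet), or there exists a shedding vertex $x$ such that both $\mathrm{link}_\Delta(x)$ and $\mathrm{del}_\Delta(x)$ are vertex decomposable. -}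

module Defs where

open import Data.Nat using (ℕ; zero; suc; _⊔_; _∸_)
open import Data.Bool using (Bool; true; false; _∧_; not)
open import Data.Fin using (Fin)
open import Data.Fin.Subset using (Subset; ⁅_⁆; _∈_; _∉_; _⊆_; _∪_; _-_; ∣_∣; ⊥)
open import Data.Fin.Subset.Properties using (_∈?_; _⊆?_)
open import Data.Vec using (Vec; []; _∷_)
open import Data.Vec.Properties using (≡-dec)
open import Data.List using (List; []; _∷_; map; _++_; filter; length; foldr)
open import Data.Bool.ListAction using (any)
import Data.Bool.Properties as BoolP
open import Data.Product using (Σ; ∃; _×_; _,_)
open import Relation.Nullary using (¬_)
open import Relation.Nullary.Decidable using (⌊_⌋)
open import Relation.Binary.PropositionalEquality using (_≡_)

-- A family of subsets of [n] = Fin n, given by a Boolean membership test.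
-- (Faces of link/deletion complexes live on the same ground set Fin n.)
Family : ℕ → Set
Family n = Subset n → Bool

allSubsets : (n : ℕ) → List (Subset n)
allSubsets zero = [] ∷ []
allSubsets (suc n) = map (false ∷_) (allSubsets n) ++ map (true ∷_) (allSubsets n)

_≟ₛ_ : ∀ {n} (F G : Subset n) → Bool
F ≟ₛ G = ⌊ ≡-dec BoolP._≟_ F G ⌋

_⊂ᵇ_ : ∀ {n} (F G : Subset n) → Bool
F ⊂ᵇ G = ⌊ F ⊆? G ⌋ ∧ not (F ≟ₛ G)

isFacetᵇ : ∀ {n} → Family n → Subset n → Bool
isFacetᵇ {n} Δ F = Δ F ∧ not (any (λ G → Δ G ∧ (F ⊂ᵇ G)) (allSubsets n))

IsFace : ∀ {n} → Family n → Subset n → Set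
IsFace Δ F = Δ F ≡ true

IsFacet : ∀ {n} → Family n → Subset n → Set
IsFacet Δ F = isFacetᵇ Δ F ≡ true

numFacets : ∀ {n} → Family n → ℕ
numFacets {n} Δ = length (filter (λ F → isFacetᵇ Δ F BoolP.≟ true) (allSubsets n))

IsSimplicialComplex : ∀ {n} → Family n → Set
IsSimplicialComplex {n} Δ =
  IsFace Δ ⊥ × (∀ (i : Fin n) → IsFace Δ ⁅ i ⁆) ×
  (∀ F G → G ⊆ F → IsFace Δ F → IsFace Δ G)

IsPure : ∀ {n} → Family n → Set
IsPure Δ = ∀ F G → IsFacet Δ F → IsFacet Δ G → ∣ F ∣ ≡ ∣ G ∣

maxFaceSize : ∀ {n} → Family n → ℕ
maxFaceSize {n} Δ = foldr (λ F m → ∣ F ∣ ⊔ m) 0 (filter (λ F → Δ F BoolP.≟ true) (allSubsets n))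

-- codimension c = n - dim Δ - 1 = n - (dim Δ + 1)
codim : ∀ {n} → Family n → ℕ
codim {n} Δ = n ∸ maxFaceSize Δ

del : ∀ {n} → Family n → Fin n → Family n
del Δ x G = not ⌊ x ∈? G ⌋ ∧ Δ G

link : ∀ {n} → Family n → Fin n → Family n
link Δ x G = not ⌊ x ∈? G ⌋ ∧ Δ (G ∪ ⁅ x ⁆)

IsSheddingVertex : ∀ {n} → Family n → Fin n → Set
IsSheddingVertex {n} Δ x =
  ∀ F → IsFacet Δ F → x ∈ F →
    Σ (Fin n) (λ y → (y ∉ F) × IsFace Δ ((F - x) ∪ ⁅ y ⁆))

IsEmptyComplex : ∀ {n} → Family n → Set
IsEmptyComplex Δ = IsFace Δ ⊥ × (∀ G → IsFace Δ G → G ≡ ⊥)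

IsSimplex : ∀ {n} → Family n → Set
IsSimplex Δ = Σ _ (λ F → IsFacet Δ F × (∀ G → IsFacet Δ G → G ≡ F))

data VertexDecomposable {n : ℕ} (Δ : Family n) : Set where
  vd-empty   : IsEmptyComplex Δ → VertexDecomposable Δ
  vd-simplex : IsSimplex Δ → VertexDecomposable Δ
  vd-shed    : (x : Fin n) → IsFace Δ ⁅ x ⁆ → IsSheddingVertex Δ x →
               VertexDecomposable (link Δ x) → VertexDecomposable (del Δ x) →
               VertexDecomposable Δ

-- A pure complex whose facets have size d, on a vertex set V of size c + d, is determined
-- by the list M of d-subsets of V that are not faces, and the hypothesis says |M| ≤ 2c - 1; we induct
-- on (c, d). A vertex lying in no facet is dropped: at least two missing sets pass through it, so the
-- budget for codimension c - 1 is met. Otherwise take a vertex x lying in the most missing sets. It is a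
-- shedding vertex: if x could not be exchanged out of a facet K, the c + 1 sets (K - x) ∪ {y} would all
-- be missing, putting c + 1 missing sets through another vertex of K (hence through x) and c + 1 more
-- avoiding x. The link of x has codimension c and at most |M| missing sets; the deletion has
-- codimension c - 1 and keeps only the missing sets avoiding x, at most 2c - 3 of them unless every
-- vertex lies in at most one missing set, where counting disjoint sets gives the bound.

module Submission where

open import Defs
open import Data.Nat using (ℕ; _+_; _*_; _≤_; suc)
open import Data.Nat.Combinatorics using (_C_)

open import Data.Bool using (Bool; true; false; _∧_; not)
open import Data.Bool.Properties using (¬-not; ∨-zeroʳ) renaming (_≟_ to _≟ᵇ_)
open import Data.Bool.ListAction using (any)
open import Data.Empty using (⊥-elim)
open import Data.Fin as Fin using (Fin)
import Data.Fin.Properties as Finₚ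
open import Data.Fin.Subset
  using (Subset; Nonempty; ⁅_⁆; _∈_; _∉_; _⊆_; _∪_; _─_; _-_; ∣_∣; inside; outside; ⊤)
  renaming (⊥ to ∅)
open import Data.Fin.Subset.Properties
  using ( _∈?_; _⊆?_; anySubset?; drop-∷-⊆; ⊆-refl; ⊆-trans; ⊆-antisym; ⊆-min; ⊆⊤; ∣⊤∣≡n; ∣p∣≤n
        ; p⊆q⇒∣p∣≤∣q∣; x∈⁅x⁆; x∈⁅y⁆⇒x≡y; x∉⁅y⁆⇒x≢y; ∣⁅x⁆∣≡1; p⊆p∪q; q⊆p∪q; x∈p∪q⁻
        ; x∈p∧x∉q⇒x∈p─q; p─q⊆p; x∈p∧x≢y⇒x∈p-y)
open import Data.List using (List; []; _∷_; map; _++_; filter; length; foldr; allFin)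
open import Data.List.Properties
  using (length-removeAt′; length-filter; length-map; length-++; filter-++; filter-none; filter-accept)
open import Data.List.Relation.Unary.Any as Any using (here; there)
import Data.List.Relation.Unary.All as All
open import Data.List.Relation.Unary.All.Properties using (all-filter; map⁺)
open import Data.List.Membership.Propositional using () renaming (_∈_ to _∈ₗ_; _∉_ to _∉ₗ_)
open import Data.List.Membership.Propositional.Properties
  using (∈-length; ∈-map⁺; ∈-map⁻; ∈-filter⁺; ∈-filter⁻; ∈-++⁺ˡ; ∈-++⁺ʳ; ∈-allFin)
open import Data.Nat using (zero; _<_; _∸_; _⊔_; z≤n; s≤s; z<s; _≟_; _≤?_)
open import Data.Nat.Properties
open import Data.Nat.Induction using (<-rec)
import Data.Nat.Combinatorics as ℕC
open import Data.Product using (∃; _×_; _,_; proj₁; proj₂)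
open import Data.Sum using (_⊎_; inj₁; inj₂; [_,_]′)
open import Data.Vec using ([]; _∷_; here; there)
open import Data.Vec.Properties using (≡-dec)
open import Function using (_∘_)
open import Relation.Nullary using (¬_; Dec; yes; no; does; contradiction; ¬?)
open import Relation.Nullary.Decidable using (⌊_⌋; _×-dec_; map′; decidable-stable)
open import Relation.Unary using (Decidable)
open import Relation.Unary.Properties using (∁?)
open import Relation.Binary.PropositionalEquality
  using (_≡_; _≢_; refl; sym; trans; cong; cong₂; subst; subst₂; module ≡-Reasoning)

open import Data.List.Extrema ≤-totalOrder using (argmax; argmax-all; f[xs]≤f[argmax])

private
  variable
    n : ℕ
    x y : Fin n
    p q : Subset n

_≟ˢ_ : (p q : Subset n) → Dec (p ≡ q)
_≟ˢ_ = ≡-dec _≟ᵇ_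

_∈ₗ?_ : (p : Subset n) (ps : List (Subset n)) → Dec (p ∈ₗ ps)
p ∈ₗ? ps = Any.any? (p ≟ˢ_) ps

∣p─q∣+∣q∣≡∣p∣ : ∀ (p q : Subset n) → q ⊆ p → ∣ p ─ q ∣ + ∣ q ∣ ≡ ∣ p ∣
∣p─q∣+∣q∣≡∣p∣ [] [] _ = refl
∣p─q∣+∣q∣≡∣p∣ (outside ∷ p) (outside ∷ q) q⊆p = ∣p─q∣+∣q∣≡∣p∣ p q (drop-∷-⊆ q⊆p)
∣p─q∣+∣q∣≡∣p∣ (inside ∷ p) (outside ∷ q) q⊆p = cong suc (∣p─q∣+∣q∣≡∣p∣ p q (drop-∷-⊆ q⊆p))
∣p─q∣+∣q∣≡∣p∣ (outside ∷ p) (inside ∷ q) q⊆p with q⊆p here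
... | ()
∣p─q∣+∣q∣≡∣p∣ (inside ∷ p) (inside ∷ q) q⊆p =
  trans (+-suc ∣ p ─ q ∣ ∣ q ∣) (cong suc (∣p─q∣+∣q∣≡∣p∣ p q (drop-∷-⊆ q⊆p)))

0<∣p∣⇒Nonempty : ∀ (p : Subset n) → 0 < ∣ p ∣ → Nonempty p
0<∣p∣⇒Nonempty (inside ∷ p) _ = Fin.zero , here
0<∣p∣⇒Nonempty (outside ∷ p) 0<∣p∣ =
  let x , x∈p = 0<∣p∣⇒Nonempty p 0<∣p∣ in Fin.suc x , there x∈p

x∈p⇒⁅x⁆⊆p : x ∈ p → ⁅ x ⁆ ⊆ p
x∈p⇒⁅x⁆⊆p {x = x} x∈p y∈⁅x⁆ rewrite x∈⁅y⁆⇒x≡y x y∈⁅x⁆ = x∈p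

x∈p⇒suc∣p-x∣≡∣p∣ : ∀ (p : Subset n) → x ∈ p → suc ∣ p - x ∣ ≡ ∣ p ∣
x∈p⇒suc∣p-x∣≡∣p∣ {x = x} p x∈p = begin
  suc ∣ p - x ∣          ≡⟨ +-comm 1 ∣ p - x ∣ ⟩
  ∣ p - x ∣ + 1          ≡⟨ cong (∣ p - x ∣ +_) (∣⁅x⁆∣≡1 x) ⟨
  ∣ p - x ∣ + ∣ ⁅ x ⁆ ∣  ≡⟨ ∣p─q∣+∣q∣≡∣p∣ p ⁅ x ⁆ (x∈p⇒⁅x⁆⊆p x∈p) ⟩
  ∣ p ∣                  ∎
  where open ≡-Reasoning

x∈p⇒∣p-x∣≡k : ∀ {k} (p : Subset n) → x ∈ p → ∣ p ∣ ≡ suc k → ∣ p - x ∣ ≡ k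
x∈p⇒∣p-x∣≡k p x∈p ∣p∣≡ = suc-injective (trans (x∈p⇒suc∣p-x∣≡∣p∣ p x∈p) ∣p∣≡)

x∈p⇒0<∣p∣ : ∀ (p : Subset n) → x ∈ p → 0 < ∣ p ∣
x∈p⇒0<∣p∣ p x∈p = subst (0 <_) (x∈p⇒suc∣p-x∣≡∣p∣ p x∈p) z<s

x∈p─q⁻ : ∀ (p q : Subset n) → x ∈ p ─ q → x ∈ p × x ∉ q
x∈p─q⁻ p q x∈p─q = p─q⊆p p q x∈p─q , ∉q p q x∈p─q
  where
  ∉q : ∀ {n} {x : Fin n} (p q : Subset n) → x ∈ p ─ q → x ∉ q
  ∉q (_ ∷ p) (inside ∷ q) () here
  ∉q (_ ∷ p) (_ ∷ q) (there x∈p─q) (there x∈q) = ∉q p q x∈p─q x∈q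

x∈p-y⁻ : ∀ (p : Subset n) → x ∈ p - y → x ∈ p × x ≢ y
x∈p-y⁻ {y = y} p x∈p-y =
  let x∈p , x∉⁅y⁆ = x∈p─q⁻ p ⁅ y ⁆ x∈p-y in x∈p , x∉⁅y⁆⇒x≢y x∉⁅y⁆

x∉p-x : ∀ (p : Subset n) → x ∉ p - x
x∉p-x p x∈p-x = proj₂ (x∈p-y⁻ p x∈p-x) refl

p⊆q-x⇒x∉p : p ⊆ q - x → x ∉ p
p⊆q-x⇒x∉p {q = q} p⊆q-x = x∉p-x q ∘ p⊆q-x

p⊆q⇒p-x⊆q-x : p ⊆ q → p - x ⊆ q - x
p⊆q⇒p-x⊆q-x {p = p} p⊆q y∈ = let y∈p , y≢x = x∈p-y⁻ p y∈ in x∈p∧x≢y⇒x∈p-y (p⊆q y∈p) y≢x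

p⊆q∧x∉p⇒p⊆q-x : p ⊆ q → x ∉ p → p ⊆ q - x
p⊆q∧x∉p⇒p⊆q-x p⊆q x∉p y∈p = x∈p∧x≢y⇒x∈p-y (p⊆q y∈p) λ { refl → x∉p y∈p }

p⊆q⇒∣q∣≤∣p∣⇒p≡q : p ⊆ q → ∣ q ∣ ≤ ∣ p ∣ → p ≡ q
p⊆q⇒∣q∣≤∣p∣⇒p≡q {p = p} {q} p⊆q ∣q∣≤∣p∣ = ⊆-antisym p⊆q q⊆p
  where
  ∣q─p∣≡0 : ∣ q ─ p ∣ ≡ 0
  ∣q─p∣≡0 = n≤0⇒n≡0 (+-cancelʳ-≤ ∣ p ∣ ∣ q ─ p ∣ 0
    (subst (_≤ ∣ p ∣) (sym (∣p─q∣+∣q∣≡∣p∣ q p p⊆q)) ∣q∣≤∣p∣))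
  q⊆p : q ⊆ p
  q⊆p {x} x∈q with x ∈? p
  ... | yes x∈p = x∈p
  ... | no x∉p = contradiction (subst (0 <_) ∣q─p∣≡0 (x∈p⇒0<∣p∣ (q ─ p) (x∈p∧x∉q⇒x∈p─q x∈q x∉p))) n≮0

p⊆q⇒p≢q⇒∣p∣<∣q∣ : p ⊆ q → p ≢ q → ∣ p ∣ < ∣ q ∣
p⊆q⇒p≢q⇒∣p∣<∣q∣ p⊆q p≢q = ≰⇒> (p≢q ∘ p⊆q⇒∣q∣≤∣p∣⇒p≡q p⊆q)

∣p∣≡1⇒p≡⁅x⁆ : ∣ p ∣ ≡ 1 → x ∈ p → p ≡ ⁅ x ⁆
∣p∣≡1⇒p≡⁅x⁆ {x = x} ∣p∣≡1 x∈p =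
  sym (p⊆q⇒∣q∣≤∣p∣⇒p≡q (x∈p⇒⁅x⁆⊆p x∈p) (≤-reflexive (trans ∣p∣≡1 (sym (∣⁅x⁆∣≡1 x)))))

other-element : x ∈ p → 1 < ∣ p ∣ → ∃ λ z → z ∈ p × z ≢ x
other-element {x = x} {p = p} x∈p 1<∣p∣ =
  let z , z∈p-x = 0<∣p∣⇒Nonempty (p - x) (≤-pred (subst (1 <_) (sym (x∈p⇒suc∣p-x∣≡∣p∣ p x∈p)) 1<∣p∣))
  in z , x∈p-y⁻ p z∈p-x

x∈p∪⁅x⁆ : ∀ (p : Subset n) x → x ∈ p ∪ ⁅ x ⁆
x∈p∪⁅x⁆ p x = q⊆p∪q p ⁅ x ⁆ (x∈⁅x⁆ x)

x∈p⇒p-x∪⁅x⁆≡p : ∀ (p : Subset n) → x ∈ p → (p - x) ∪ ⁅ x ⁆ ≡ p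
x∈p⇒p-x∪⁅x⁆≡p {x = x} p x∈p = ⊆-antisym ⊆p p⊆
  where
  ⊆p : (p - x) ∪ ⁅ x ⁆ ⊆ p
  ⊆p y∈ with x∈p∪q⁻ (p - x) ⁅ x ⁆ y∈
  ... | inj₁ y∈p-x = proj₁ (x∈p-y⁻ p y∈p-x)
  ... | inj₂ y∈⁅x⁆ rewrite x∈⁅y⁆⇒x≡y x y∈⁅x⁆ = x∈p
  p⊆ : p ⊆ (p - x) ∪ ⁅ x ⁆
  p⊆ {y} y∈p with y Fin.≟ x
  ... | yes refl = x∈p∪⁅x⁆ (p - x) x
  ... | no y≢x = p⊆p∪q ⁅ x ⁆ (x∈p∧x≢y⇒x∈p-y y∈p y≢x)

x∉p⇒p∪⁅x⁆-x≡p : ∀ (p : Subset n) → x ∉ p → (p ∪ ⁅ x ⁆) - x ≡ p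
x∉p⇒p∪⁅x⁆-x≡p {x = x} p x∉p = ⊆-antisym ⊆p p⊆
  where
  ⊆p : (p ∪ ⁅ x ⁆) - x ⊆ p
  ⊆p y∈ with x∈p-y⁻ (p ∪ ⁅ x ⁆) y∈
  ... | y∈p∪⁅x⁆ , y≢x with x∈p∪q⁻ p ⁅ x ⁆ y∈p∪⁅x⁆
  ...   | inj₁ y∈p = y∈p
  ...   | inj₂ y∈⁅x⁆ = contradiction (x∈⁅y⁆⇒x≡y x y∈⁅x⁆) y≢x
  p⊆ : p ⊆ (p ∪ ⁅ x ⁆) - x
  p⊆ y∈p = x∈p∧x≢y⇒x∈p-y (p⊆p∪q ⁅ x ⁆ y∈p) λ { refl → x∉p y∈p }

x∉p⇒∣p∪⁅x⁆∣≡suc∣p∣ : ∀ (p : Subset n) → x ∉ p → ∣ p ∪ ⁅ x ⁆ ∣ ≡ suc ∣ p ∣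
x∉p⇒∣p∪⁅x⁆∣≡suc∣p∣ {x = x} p x∉p = begin
  ∣ p ∪ ⁅ x ⁆ ∣              ≡⟨ x∈p⇒suc∣p-x∣≡∣p∣ (p ∪ ⁅ x ⁆) (x∈p∪⁅x⁆ p x) ⟨
  suc ∣ (p ∪ ⁅ x ⁆) - x ∣    ≡⟨ cong (suc ∘ ∣_∣) (x∉p⇒p∪⁅x⁆-x≡p p x∉p) ⟩
  suc ∣ p ∣                  ∎
  where open ≡-Reasoning

exchange : Subset n → Fin n → Fin n → Subset n
exchange p x y = (p - x) ∪ ⁅ y ⁆

y∈exchange : ∀ (p : Subset n) x y → y ∈ exchange p x y
y∈exchange p x y = x∈p∪⁅x⁆ (p - x) y

z∈exchange : ∀ {z} → z ∈ p → z ≢ x → z ∈ exchange p x y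
z∈exchange {y = y} z∈p z≢x = p⊆p∪q ⁅ y ⁆ (x∈p∧x≢y⇒x∈p-y z∈p z≢x)

x∉exchange : x ≢ y → x ∉ exchange p x y
x∉exchange {x = x} {y} {p} x≢y x∈ with x∈p∪q⁻ (p - x) ⁅ y ⁆ x∈
... | inj₁ x∈p-x = x∉p-x p x∈p-x
... | inj₂ x∈⁅y⁆ = x≢y (x∈⁅y⁆⇒x≡y y x∈⁅y⁆)

exchange-⊆ : p ⊆ q → y ∈ q → exchange p x y ⊆ q
exchange-⊆ {p = p} {y = y} {x} p⊆q y∈q z∈ with x∈p∪q⁻ (p - x) ⁅ y ⁆ z∈
... | inj₁ z∈p-x = p⊆q (proj₁ (x∈p-y⁻ p z∈p-x))
... | inj₂ z∈⁅y⁆ rewrite x∈⁅y⁆⇒x≡y y z∈⁅y⁆ = y∈q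

∣exchange∣ : x ∈ p → y ∉ p → ∣ exchange p x y ∣ ≡ ∣ p ∣
∣exchange∣ {x = x} {p} x∈p y∉p =
  trans (x∉p⇒∣p∪⁅x⁆∣≡suc∣p∣ (p - x) (y∉p ∘ proj₁ ∘ x∈p-y⁻ p)) (x∈p⇒suc∣p-x∣≡∣p∣ p x∈p)

exchange-injective : ∀ {z} → y ∉ p → exchange p x y ≡ exchange p x z → y ≡ z
exchange-injective {y = y} {p} {x} {z} y∉p eq with x∈p∪q⁻ (p - x) ⁅ z ⁆ (subst (y ∈_) eq (y∈exchange p x y))
... | inj₁ y∈p-x = contradiction (proj₁ (x∈p-y⁻ p y∈p-x)) y∉p
... | inj₂ y∈⁅z⁆ = x∈⁅y⁆⇒x≡y z y∈⁅z⁆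

module _ {A : Set} where

  ∈-─⁺ : ∀ {xs : List A} {a b} (a∈xs : a ∈ₗ xs) → b ∈ₗ xs → b ≢ a → b ∈ₗ (xs Any.─ a∈xs)
  ∈-─⁺ (here refl) (here refl) b≢a = contradiction refl b≢a
  ∈-─⁺ (here refl) (there b∈xs) _ = b∈xs
  ∈-─⁺ (there a∈xs) (here refl) _ = here refl
  ∈-─⁺ (there a∈xs) (there b∈xs) b≢a = there (∈-─⁺ a∈xs b∈xs b≢a)

  length-─ : ∀ (xs : List A) {a} (a∈xs : a ∈ₗ xs) → length xs ≡ suc (length (xs Any.─ a∈xs))
  length-─ xs a∈xs = length-removeAt′ xs (Any.index a∈xs)

  0<length⇒∈ : ∀ {xs : List A} → 0 < length xs → ∃ (_∈ₗ xs)
  0<length⇒∈ {_ ∷ _} _ = _ , here refl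

  distinct⇒2≤length : ∀ {xs : List A} {a b} → a ∈ₗ xs → b ∈ₗ xs → b ≢ a → 2 ≤ length xs
  distinct⇒2≤length {xs} a∈xs b∈xs b≢a =
    subst (2 ≤_) (sym (length-─ xs a∈xs)) (s≤s (∈-length (∈-─⁺ a∈xs b∈xs b≢a)))

  length-filter+length-filter-∁ : ∀ {P : A → Set} (P? : Decidable P) xs →
    length (filter P? xs) + length (filter (∁? P?) xs) ≡ length xs
  length-filter+length-filter-∁ P? [] = refl
  length-filter+length-filter-∁ P? (x ∷ xs) with P? x
  ... | yes _ = cong suc (length-filter+length-filter-∁ P? xs)
  ... | no _ = trans (+-suc _ _) (cong suc (length-filter+length-filter-∁ P? xs))

  length-filter-partition : ∀ {P Q R : A → Set} (P? : Decidable P) (Q? : Decidable Q) (R? : Decidable R) xs →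
    (∀ {x} → R x → P x ⊎ Q x) → (∀ {x} → P x → R x) → (∀ {x} → Q x → R x) → (∀ {x} → P x → ¬ Q x) →
    length (filter P? xs) + length (filter Q? xs) ≡ length (filter R? xs)
  length-filter-partition P? Q? R? [] _ _ _ _ = refl
  length-filter-partition P? Q? R? (x ∷ xs) R⇒P⊎Q P⇒R Q⇒R P⇒¬Q with P? x | Q? x | R? x
  ... | yes px | yes qx | _ = contradiction qx (P⇒¬Q px)
  ... | yes px | no _ | no ¬rx = contradiction (P⇒R px) ¬rx
  ... | no _ | yes qx | no ¬rx = contradiction (Q⇒R qx) ¬rx
  ... | no ¬px | no ¬qx | yes rx = ⊥-elim ([ ¬px , ¬qx ]′ (R⇒P⊎Q rx))
  ... | yes _ | no _ | yes _ = cong suc (length-filter-partition P? Q? R? xs R⇒P⊎Q P⇒R Q⇒R P⇒¬Q)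
  ... | no _ | yes _ | yes _ =
    trans (+-suc _ _) (cong suc (length-filter-partition P? Q? R? xs R⇒P⊎Q P⇒R Q⇒R P⇒¬Q))
  ... | no _ | no _ | no _ = length-filter-partition P? Q? R? xs R⇒P⊎Q P⇒R Q⇒R P⇒¬Q

  any-true : ∀ (f : A → Bool) {xs a} → a ∈ₗ xs → f a ≡ true → any f xs ≡ true
  any-true f (here refl) fa≡true rewrite fa≡true = refl
  any-true f {b ∷ _} (there a∈xs) fa≡true rewrite any-true f a∈xs fa≡true = ∨-zeroʳ (f b)

  any-false : ∀ (f : A → Bool) xs → (∀ a → f a ≡ false) → any f xs ≡ false
  any-false f [] _ = refl
  any-false f (a ∷ xs) f≡false rewrite f≡false a = any-false f xs f≡false

  foldr-⊔-upper : ∀ (f : A → ℕ) {xs a} → a ∈ₗ xs → f a ≤ foldr (λ b m → f b ⊔ m) 0 xs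
  foldr-⊔-upper f (here refl) = m≤m⊔n _ _
  foldr-⊔-upper f (there a∈xs) = ≤-trans (foldr-⊔-upper f a∈xs) (m≤n⊔m _ _)

  foldr-⊔-attained : ∀ (f : A → ℕ) {xs a} → a ∈ₗ xs →
    ∃ λ b → b ∈ₗ xs × f b ≡ foldr (λ b m → f b ⊔ m) 0 xs
  foldr-⊔-attained f {b ∷ xs} _ = attained b xs
    where
    attained : ∀ b xs → ∃ λ a → a ∈ₗ b ∷ xs × f a ≡ foldr (λ b m → f b ⊔ m) 0 (b ∷ xs)
    attained b [] = b , here refl , sym (⊔-identityʳ (f b))
    attained b (c ∷ xs) with ⊔-sel (f b) (foldr (λ b m → f b ⊔ m) 0 (c ∷ xs)) | attained c xs
    ... | inj₁ eq | _ = b , here refl , sym eq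
    ... | inj₂ eq | a , a∈xs , fa≡ = a , there a∈xs , trans fa≡ (sym eq)

  length-filter-map : ∀ {B : Set} {P : A → Set} {Q : B → Set} (P? : Decidable P) (Q? : Decidable Q)
    (f : B → A) xs → (∀ y → does (P? (f y)) ≡ does (Q? y)) →
    length (filter P? (map f xs)) ≡ length (filter Q? xs)
  length-filter-map P? Q? f [] _ = refl
  length-filter-map P? Q? f (y ∷ xs) same with P? (f y) | Q? y | same y
  ... | yes _ | yes _ | _ = cong suc (length-filter-map P? Q? f xs same)
  ... | no _ | no _ | _ = length-filter-map P? Q? f xs same

injectiveOn⇒∣W∣≤length : ∀ {A : Set} (W : Subset n) (f : Fin n → A) (xs : List A) →
  (∀ {y z} → y ∈ W → z ∈ W → f y ≡ f z → y ≡ z) → (∀ {y} → y ∈ W → f y ∈ₗ xs) → ∣ W ∣ ≤ length xs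
injectiveOn⇒∣W∣≤length {n} W f xs = go ∣ W ∣ W refl xs
  where
  go : ∀ k (W : Subset n) → ∣ W ∣ ≡ k → ∀ xs → (∀ {y z} → y ∈ W → z ∈ W → f y ≡ f z → y ≡ z) →
       (∀ {y} → y ∈ W → f y ∈ₗ xs) → k ≤ length xs
  go zero _ _ _ _ _ = z≤n
  go (suc k) W ∣W∣≡ xs inj into with 0<∣p∣⇒Nonempty W (subst (0 <_) (sym ∣W∣≡) z<s)
  ... | w , w∈W = subst (suc k ≤_) (sym (length-─ xs (into w∈W)))
    (s≤s (go k (W - w) (x∈p⇒∣p-x∣≡k W w∈W ∣W∣≡) (xs Any.─ into w∈W) inj′ into′))
    where
    inj′ : ∀ {a b} → a ∈ W - w → b ∈ W - w → f a ≡ f b → a ≡ b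
    inj′ a∈ b∈ = inj (proj₁ (x∈p-y⁻ W a∈)) (proj₁ (x∈p-y⁻ W b∈))
    into′ : ∀ {z} → z ∈ W - w → f z ∈ₗ (xs Any.─ into w∈W)
    into′ z∈ = let z∈W , z≢w = x∈p-y⁻ W z∈ in
      ∈-─⁺ (into w∈W) (into z∈W) (z≢w ∘ inj z∈W w∈W)

argmaxOn : (f : Fin n → ℕ) (V : Subset n) → Nonempty V → ∃ λ x → x ∈ V × (∀ {y} → y ∈ V → f y ≤ f x)
argmaxOn {n} f V (x₀ , x₀∈V) = best , argmax-all f x₀∈V (all-filter (_∈? V) (allFin n)) , maximal
  where
  vertices : List (Fin n)
  vertices = filter (_∈? V) (allFin n)
  best : Fin n
  best = argmax f x₀ vertices
  maximal : ∀ {y} → y ∈ V → f y ≤ f best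
  maximal y∈V = All.lookup (f[xs]≤f[argmax] x₀ vertices) (∈-filter⁺ (_∈? V) (∈-allFin _) y∈V)

module _ {P : Set} where

  isYes-true⁺ : (P? : Dec P) → P → ⌊ P? ⌋ ≡ true
  isYes-true⁺ (yes _) _ = refl
  isYes-true⁺ (no ¬p) p = contradiction p ¬p

  isYes-true⁻ : (P? : Dec P) → ⌊ P? ⌋ ≡ true → P
  isYes-true⁻ (yes p) _ = p

  isYes-false⁺ : (P? : Dec P) → ¬ P → ⌊ P? ⌋ ≡ false
  isYes-false⁺ (yes p) ¬p = contradiction p ¬p
  isYes-false⁺ (no _) _ = refl

  isYes-false⁻ : (P? : Dec P) → ⌊ P? ⌋ ≡ false → ¬ P
  isYes-false⁻ (no ¬p) _ = ¬p

∧-true⁻ : ∀ {a b} → a ∧ b ≡ true → a ≡ true × b ≡ true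
∧-true⁻ {true} {true} _ = refl , refl

not-true⁻ : ∀ {b} → not b ≡ true → b ≡ false
not-true⁻ {false} _ = refl

∈-allSubsets : ∀ (H : Subset n) → H ∈ₗ allSubsets n
∈-allSubsets [] = here refl
∈-allSubsets {suc n} (false ∷ H) = ∈-++⁺ˡ (∈-map⁺ (false ∷_) (∈-allSubsets H))
∈-allSubsets {suc n} (true ∷ H) = ∈-++⁺ʳ (map (false ∷_) (allSubsets n)) (∈-map⁺ (true ∷_) (∈-allSubsets H))

⊂ᵇ⁺ : ∀ {F G : Subset n} → F ⊆ G → F ≢ G → (F ⊂ᵇ G) ≡ true
⊂ᵇ⁺ {F = F} {G} F⊆G F≢G = cong₂ (λ a b → a ∧ not b) (isYes-true⁺ (F ⊆? G) F⊆G) (isYes-false⁺ (F ≟ˢ G) F≢G)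

⊂ᵇ⁻ : ∀ {F G : Subset n} → (F ⊂ᵇ G) ≡ true → F ⊆ G × F ≢ G
⊂ᵇ⁻ {F = F} {G} F⊂G = let F⊆G , F≢G = ∧-true⁻ {⌊ F ⊆? G ⌋} F⊂G in
  isYes-true⁻ (F ⊆? G) F⊆G , isYes-false⁻ (F ≟ˢ G) (not-true⁻ F≢G)

module _ {Δ : Family n} {x : Fin n} {G : Subset n} where

  link-face⁺ : x ∉ G → IsFace Δ (G ∪ ⁅ x ⁆) → IsFace (link Δ x) G
  link-face⁺ x∉G ΔG∪x = cong₂ (λ a b → not a ∧ b) (isYes-false⁺ (x ∈? G) x∉G) ΔG∪x

  link-face⁻ : IsFace (link Δ x) G → x ∉ G × IsFace Δ (G ∪ ⁅ x ⁆)
  link-face⁻ face = let x∉G , ΔG∪x = ∧-true⁻ {not ⌊ x ∈? G ⌋} face in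
    isYes-false⁻ (x ∈? G) (not-true⁻ x∉G) , ΔG∪x

  del-face⁺ : x ∉ G → IsFace Δ G → IsFace (del Δ x) G
  del-face⁺ x∉G ΔG = cong₂ (λ a b → not a ∧ b) (isYes-false⁺ (x ∈? G) x∉G) ΔG

  del-face⁻ : IsFace (del Δ x) G → x ∉ G × IsFace Δ G
  del-face⁻ face = let x∉G , ΔG = ∧-true⁻ {not ⌊ x ∈? G ⌋} face in
    isYes-false⁻ (x ∈? G) (not-true⁻ x∉G) , ΔG

Maximal : Family n → Subset n → Set
Maximal Δ F = ∀ {G} → IsFace Δ G → F ⊆ G → F ≡ G

module _ {Δ : Family n} {F : Subset n} where

  isFacet⁺ : IsFace Δ F → Maximal Δ F → IsFacet Δ F
  isFacet⁺ ΔF maximal = cong₂ (λ a b → a ∧ not b) ΔF (any-false _ (allSubsets n) noLargerFace)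
    where
    noLargerFace : ∀ G → (Δ G ∧ (F ⊂ᵇ G)) ≡ false
    noLargerFace G = ¬-not λ larger →
      let ΔG , F⊂G = ∧-true⁻ {Δ G} larger
          F⊆G , F≢G = ⊂ᵇ⁻ F⊂G
      in F≢G (maximal ΔG F⊆G)

  isFacet⁻ : IsFacet Δ F → IsFace Δ F × Maximal Δ F
  isFacet⁻ facet = ΔF , maximal
    where
    ΔF : IsFace Δ F
    ΔF = proj₁ (∧-true⁻ {Δ F} facet)
    noLargerFace : any (λ G → Δ G ∧ (F ⊂ᵇ G)) (allSubsets n) ≡ false
    noLargerFace = not-true⁻ (proj₂ (∧-true⁻ {Δ F} facet))
    maximal : Maximal Δ F
    maximal {G} ΔG F⊆G = decidable-stable (F ≟ˢ G) λ F≢G →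
      contradiction (trans (sym (any-true _ (∈-allSubsets G) (cong₂ _∧_ ΔG (⊂ᵇ⁺ F⊆G F≢G)))) noLargerFace) λ ()

face⊆facet : ∀ (Δ : Family n) {G} → IsFace Δ G → ∃ λ F → IsFacet Δ F × G ⊆ F
face⊆facet {n} Δ {G} = <-rec P extend (n ∸ ∣ G ∣) refl
  where
  P : ℕ → Set
  P k = ∀ {G} → n ∸ ∣ G ∣ ≡ k → IsFace Δ G → ∃ λ F → IsFacet Δ F × G ⊆ F
  extend : ∀ k → (∀ {j} → j < k → P j) → P k
  extend _ ih {G} refl ΔG with anySubset? (λ K → (Δ K ≟ᵇ true) ×-dec (G ⊆? K) ×-dec ¬? (G ≟ˢ K))
  ... | no noLargerFace =
    G , isFacet⁺ ΔG (λ {K} ΔK G⊆K → decidable-stable (G ≟ˢ K) λ G≢K → noLargerFace (K , ΔK , G⊆K , G≢K)) ,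
    ⊆-refl
  ... | yes (K , ΔK , G⊆K , G≢K) =
    let F , facet , K⊆F = ih (∸-monoʳ-< (p⊆q⇒p≢q⇒∣p∣<∣q∣ G⊆K G≢K) (∣p∣≤n K)) refl ΔK in
    F , facet , ⊆-trans G⊆K K⊆F

-- Complexes presented by their missing facets

record Generator (V : Subset n) (d : ℕ) (M : List (Subset n)) (H : Subset n) : Set where
  constructor generator
  field
    ⊆V : H ⊆ V
    card : ∣ H ∣ ≡ d
    ∉M : H ∉ₗ M
open Generator

generator? : ∀ (V : Subset n) d M H → Dec (Generator V d M H)
generator? V d M H = map′ fromParts toParts ((H ⊆? V) ×-dec (∣ H ∣ ≟ d) ×-dec ¬? (H ∈ₗ? M))
  where
  fromParts : H ⊆ V × ∣ H ∣ ≡ d × H ∉ₗ M → Generator V d M H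
  fromParts (H⊆V , ∣H∣≡d , H∉M) = generator H⊆V ∣H∣≡d H∉M
  toParts : Generator V d M H → H ⊆ V × ∣ H ∣ ≡ d × H ∉ₗ M
  toParts (generator H⊆V ∣H∣≡d H∉M) = H⊆V , ∣H∣≡d , H∉M

¬generator⇒missing : ∀ {V : Subset n} {d M H} → H ⊆ V → ∣ H ∣ ≡ d → ¬ Generator V d M H → H ∈ₗ M
¬generator⇒missing {M = M} {H} H⊆V ∣H∣≡d ¬gen = decidable-stable (H ∈ₗ? M) (¬gen ∘ generator H⊆V ∣H∣≡d)

Covered : Subset n → ℕ → List (Subset n) → Subset n → Set
Covered V d M G = ∃ λ H → Generator V d M H × G ⊆ H

SubsetsOfSize : Subset n → ℕ → List (Subset n) → Set
SubsetsOfSize V d M = ∀ {G} → G ∈ₗ M → G ⊆ V × ∣ G ∣ ≡ d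

record Presentation (Δ : Family n) (V : Subset n) (d : ℕ) (M : List (Subset n)) : Set where
  field
    face⇒covered : ∀ {G} → IsFace Δ G → Covered V d M G
    covered⇒face : ∀ {G} → Covered V d M G → IsFace Δ G
    missing-sized : SubsetsOfSize V d M
open Presentation

module _ {Δ : Family n} {V d M} (P : Presentation Δ V d M) where

  generator⇒face : ∀ {H} → Generator V d M H → IsFace Δ H
  generator⇒face g = covered⇒face P (_ , g , ⊆-refl)

  facet⇒generator : ∀ {F} → IsFacet Δ F → Generator V d M F
  facet⇒generator facet =
    let ΔF , maximal = isFacet⁻ {Δ = Δ} facet
        H , g , F⊆H = face⇒covered P ΔF
    in subst (Generator V d M) (sym (maximal (generator⇒face g) F⊆H)) g

  generator⇒facet : ∀ {H} → Generator V d M H → IsFacet Δ H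
  generator⇒facet {H} g = isFacet⁺ {Δ = Δ} (generator⇒face g) maximal
    where
    maximal : Maximal Δ H
    maximal {G} ΔG H⊆G =
      let H′ , g′ , G⊆H′ = face⇒covered P ΔG
          H≡H′ = p⊆q⇒∣q∣≤∣p∣⇒p≡q (⊆-trans H⊆G G⊆H′) (≤-reflexive (trans (card g′) (sym (card g))))
      in ⊆-antisym H⊆G (subst (G ⊆_) (sym H≡H′) G⊆H′)

linkMissing : List (Subset n) → Fin n → List (Subset n)
linkMissing M x = map (_- x) (filter (x ∈?_) M)

delMissing : List (Subset n) → Fin n → List (Subset n)
delMissing M x = filter (∁? (x ∈?_)) M

Shedding : Subset n → ℕ → List (Subset n) → Fin n → Set
Shedding V d M x =
  ∀ {H} → Generator V d M H → x ∈ H → ∃ λ y → y ∉ H × Generator V d M (exchange H x y)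

module _ {V : Subset n} {d : ℕ} {M : List (Subset n)} {x : Fin n} where

  missing-link : SubsetsOfSize V (suc d) M → SubsetsOfSize (V - x) d (linkMissing M x)
  missing-link sized G∈ with ∈-map⁻ (_- x) G∈
  ... | K , K∈ , refl with ∈-filter⁻ (x ∈?_) K∈
  ... | K∈M , x∈K = let K⊆V , ∣K∣≡ = sized K∈M in
    p⊆q⇒p-x⊆q-x K⊆V , x∈p⇒∣p-x∣≡k K x∈K ∣K∣≡

  missing-del : SubsetsOfSize V d M → SubsetsOfSize (V - x) d (delMissing M x)
  missing-del sized G∈ with ∈-filter⁻ (∁? (x ∈?_)) G∈
  ... | G∈M , x∉G = let G⊆V , ∣G∣≡ = sized G∈M in
    p⊆q∧x∉p⇒p⊆q-x G⊆V x∉G , ∣G∣≡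

  generator-link : ∀ {H} → Generator V (suc d) M H → x ∈ H → Generator (V - x) d (linkMissing M x) (H - x)
  generator-link {H} (generator H⊆V ∣H∣≡ H∉M) x∈H =
    generator (p⊆q⇒p-x⊆q-x H⊆V) (x∈p⇒∣p-x∣≡k H x∈H ∣H∣≡) H-x∉
    where
    H-x∉ : H - x ∉ₗ linkMissing M x
    H-x∉ H-x∈ with ∈-map⁻ (_- x) H-x∈
    ... | K , K∈ , H-x≡K-x with ∈-filter⁻ (x ∈?_) K∈
    ... | K∈M , x∈K = H∉M (subst (_∈ₗ M) K≡H K∈M)
      where
      K≡H : K ≡ H
      K≡H = trans (sym (x∈p⇒p-x∪⁅x⁆≡p K x∈K))
                  (trans (cong (_∪ ⁅ x ⁆) (sym H-x≡K-x)) (x∈p⇒p-x∪⁅x⁆≡p H x∈H))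

  generator-link⁻ : ∀ {H} → x ∈ V → Generator (V - x) d (linkMissing M x) H → Generator V (suc d) M (H ∪ ⁅ x ⁆)
  generator-link⁻ {H} x∈V (generator H⊆V-x ∣H∣≡ H∉) =
    generator H∪x⊆V (trans (x∉p⇒∣p∪⁅x⁆∣≡suc∣p∣ H x∉H) (cong suc ∣H∣≡)) H∪x∉M
    where
    x∉H : x ∉ H
    x∉H = p⊆q-x⇒x∉p H⊆V-x
    H∪x⊆V : H ∪ ⁅ x ⁆ ⊆ V
    H∪x⊆V y∈ with x∈p∪q⁻ H ⁅ x ⁆ y∈
    ... | inj₁ y∈H = proj₁ (x∈p-y⁻ V (H⊆V-x y∈H))
    ... | inj₂ y∈⁅x⁆ rewrite x∈⁅y⁆⇒x≡y x y∈⁅x⁆ = x∈V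
    H∪x∉M : H ∪ ⁅ x ⁆ ∉ₗ M
    H∪x∉M H∪x∈M = H∉ (subst (_∈ₗ linkMissing M x) (x∉p⇒p∪⁅x⁆-x≡p H x∉H)
      (∈-map⁺ (_- x) (∈-filter⁺ (x ∈?_) H∪x∈M (x∈p∪⁅x⁆ H x))))

  generator-del : ∀ {H} → Generator V d M H → x ∉ H → Generator (V - x) d (delMissing M x) H
  generator-del (generator H⊆V ∣H∣≡ H∉M) x∉H =
    generator (p⊆q∧x∉p⇒p⊆q-x H⊆V x∉H) ∣H∣≡
              (H∉M ∘ proj₁ ∘ ∈-filter⁻ (∁? (x ∈?_)))

  generator-del⁻ : ∀ {H} → Generator (V - x) d (delMissing M x) H → Generator V d M H × x ∉ H
  generator-del⁻ {H} (generator H⊆V-x ∣H∣≡ H∉) =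
    generator (proj₁ ∘ x∈p-y⁻ V ∘ H⊆V-x) ∣H∣≡ (λ H∈M → H∉ (∈-filter⁺ (∁? (x ∈?_)) H∈M x∉H)) , x∉H
    where
    x∉H : x ∉ H
    x∉H = p⊆q-x⇒x∉p H⊆V-x

module _ {Δ : Family n} {V : Subset n} {d : ℕ} {M : List (Subset n)} {x : Fin n} where

  link-presentation : x ∈ V → Presentation Δ V (suc d) M → Presentation (link Δ x) (V - x) d (linkMissing M x)
  link-presentation x∈V P = record
    { face⇒covered = λ {G} face → let x∉G , ΔG∪x = link-face⁻ {Δ = Δ} face
                                      H , g , G∪x⊆H = face⇒covered P ΔG∪x
                                      x∈H = G∪x⊆H (x∈p∪⁅x⁆ G x)
                                  in H - x , generator-link g x∈H ,
                                     p⊆q∧x∉p⇒p⊆q-x (G∪x⊆H ∘ p⊆p∪q ⁅ x ⁆) x∉G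
    ; covered⇒face = λ {G} (H , g , G⊆H) →
        link-face⁺ {Δ = Δ} (p⊆q-x⇒x∉p (⊆-trans G⊆H (⊆V g)))
          (covered⇒face P (H ∪ ⁅ x ⁆ , generator-link⁻ x∈V g , ∪-monoˡ-⊆ G⊆H))
    ; missing-sized = missing-link (missing-sized P)
    }
    where
    ∪-monoˡ-⊆ : ∀ {G H} → G ⊆ H → G ∪ ⁅ x ⁆ ⊆ H ∪ ⁅ x ⁆
    ∪-monoˡ-⊆ {G} {H} G⊆H y∈ with x∈p∪q⁻ G ⁅ x ⁆ y∈
    ... | inj₁ y∈G = p⊆p∪q ⁅ x ⁆ (G⊆H y∈G)
    ... | inj₂ y∈⁅x⁆ = q⊆p∪q H ⁅ x ⁆ y∈⁅x⁆

  del-presentation : Shedding V d M x → Presentation Δ V d M → Presentation (del Δ x) (V - x) d (delMissing M x)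
  del-presentation shedding P = record
    { face⇒covered = face⇒covered′
    ; covered⇒face = λ (H , g , G⊆H) → let g′ , x∉H = generator-del⁻ g in
        del-face⁺ {Δ = Δ} (x∉H ∘ G⊆H) (covered⇒face P (H , g′ , G⊆H))
    ; missing-sized = missing-del (missing-sized P)
    }
    where
    face⇒covered′ : ∀ {G} → IsFace (del Δ x) G → Covered (V - x) d (delMissing M x) G
    face⇒covered′ {G} face with del-face⁻ {Δ = Δ} face
    ... | x∉G , ΔG with face⇒covered P ΔG
    ... | H , g , G⊆H with x ∈? H
    ... | no x∉H = H , generator-del g x∉H , G⊆H
    ... | yes x∈H with shedding g x∈H
    ... | y , y∉H , g′ =
      exchange H x y , generator-del g′ (x∉exchange λ { refl → y∉H x∈H }) ,
      p⊆p∪q ⁅ y ⁆ ∘ p⊆q∧x∉p⇒p⊆q-x G⊆H x∉G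

  unused-presentation : (∀ {H} → Generator V d M H → x ∉ H) → Presentation Δ V d M →
    Presentation Δ (V - x) d (delMissing M x)
  unused-presentation unused P = record
    { face⇒covered = λ ΔG → let H , g , G⊆H = face⇒covered P ΔG in H , generator-del g (unused g) , G⊆H
    ; covered⇒face = λ (H , g , G⊆H) → covered⇒face P (H , proj₁ (generator-del⁻ g) , G⊆H)
    ; missing-sized = missing-del (missing-sized P)
    }

generator-nonempty : ∀ {V : Subset n} {d M H} → Generator V (suc d) M H → Nonempty H
generator-nonempty {H = H} g = 0<∣p∣⇒Nonempty H (subst (0 <_) (sym (card g)) z<s)

module _ {Δ : Family n} {V : Subset n} {d M} (P : Presentation Δ V d M) where

  shedding⇒vd : ∀ {x} → Shedding V d M x → (∃ λ H → Generator V d M H × x ∈ H) →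
    VertexDecomposable (link Δ x) → VertexDecomposable (del Δ x) → VertexDecomposable Δ
  shedding⇒vd {x} shedding (H , g , x∈H) = vd-shed x (covered⇒face P (H , g , x∈p⇒⁅x⁆⊆p x∈H)) isShedding
    where
    isShedding : IsSheddingVertex Δ x
    isShedding F facet x∈F =
      let y , y∉F , g′ = shedding (facet⇒generator P facet) x∈F in y , y∉F , generator⇒face P g′

  simplex-vd : ∣ V ∣ ≡ d → ∃ (Generator V d M) → VertexDecomposable Δ
  simplex-vd ∣V∣≡d (H , g) =
    vd-simplex (V , generator⇒facet P (subst (Generator V d M) (isV g) g) , λ _ → isV ∘ facet⇒generator P)
    where
    isV : ∀ {K} → Generator V d M K → K ≡ V
    isV g = p⊆q⇒∣q∣≤∣p∣⇒p≡q (⊆V g) (≤-reflexive (trans ∣V∣≡d (sym (card g))))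

empty-vd : ∀ {Δ : Family n} {V M} → Presentation Δ V 0 M → ∃ (Generator V 0 M) → VertexDecomposable Δ
empty-vd {Δ = Δ} P (H , g) = vd-empty (covered⇒face P (H , g , ⊆-min H) , onlyEmpty)
  where
  onlyEmpty : ∀ G → IsFace Δ G → G ≡ ∅
  onlyEmpty G ΔG = let _ , g′ , G⊆H′ = face⇒covered P ΔG in
    sym (p⊆q⇒∣q∣≤∣p∣⇒p≡q (⊆-min G) (≤-trans (p⊆q⇒∣p∣≤∣q∣ G⊆H′) (≤-trans (≤-reflexive (card g′)) z≤n)))

points-vd : ∀ c {Δ : Family n} {V M} → ∣ V ∣ ≡ c + 1 → Presentation Δ V 1 M → ∃ (Generator V 1 M) →
  VertexDecomposable Δ
points-vd zero ∣V∣≡1 P gen = simplex-vd P ∣V∣≡1 gen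
points-vd (suc c) {Δ} {V} {M} ∣V∣≡ P (H , g)
  with anySubset? (λ H′ → generator? V 1 M H′ ×-dec ¬? (H′ ≟ˢ H))
... | no onlyH = vd-simplex (H , generator⇒facet P g , λ G facet →
  decidable-stable (G ≟ˢ H) λ G≢H → onlyH (G , facet⇒generator P facet , G≢H))
... | yes (H′ , g′ , H′≢H) with generator-nonempty g | generator-nonempty g′
... | v , v∈H | w , w∈H′ =
  shedding⇒vd P shedding (H , g , v∈H)
    (empty-vd (link-presentation (⊆V g v∈H) P) (H - v , generator-link g v∈H))
    (points-vd c (x∈p⇒∣p-x∣≡k V (⊆V g v∈H) ∣V∣≡) (del-presentation shedding P) (H′ , generator-del g′ v∉H′))
  where
  v∉H′ : v ∉ H′
  v∉H′ v∈H′ = H′≢H (trans (∣p∣≡1⇒p≡⁅x⁆ (card g′) v∈H′) (sym (∣p∣≡1⇒p≡⁅x⁆ (card g) v∈H)))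
  shedding : Shedding V 1 M v
  shedding {F} gF v∈F = w , w∉F , subst (Generator V 1 M) (sym exchange≡H′) g′
    where
    w∉F : w ∉ F
    w∉F w∈F = v∉H′ (subst (_∈ H′) (x∈⁅y⁆⇒x≡y v (subst (w ∈_) (∣p∣≡1⇒p≡⁅x⁆ (card gF) v∈F) w∈F)) w∈H′)
    exchange≡H′ : exchange F v w ≡ H′
    exchange≡H′ = trans (∣p∣≡1⇒p≡⁅x⁆ (trans (∣exchange∣ v∈F w∉F) (card gF)) (y∈exchange F v w))
                        (sym (∣p∣≡1⇒p≡⁅x⁆ (card g′) w∈H′))

-- Counting missing facets

degree : List (Subset n) → Fin n → ℕ
degree M x = length (filter (x ∈?_) M)

degree-∷ : ∀ {G} (M : List (Subset n)) → x ∈ G → degree (G ∷ M) x ≡ suc (degree M x)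
degree-∷ {x = x} M x∈G = cong length (filter-accept (x ∈?_) x∈G)

degree-∷-≤ : ∀ G (M : List (Subset n)) x → degree M x ≤ degree (G ∷ M) x
degree-∷-≤ G M x with x ∈? G
... | yes _ = n≤1+n _
... | no _ = ≤-refl

degree+length-delMissing : ∀ (M : List (Subset n)) x → degree M x + length (delMissing M x) ≡ length M
degree+length-delMissing M x = length-filter+length-filter-∁ (x ∈?_) M

length-linkMissing≤ : ∀ (M : List (Subset n)) x → length (linkMissing M x) ≤ length M
length-linkMissing≤ M x = ≤-trans (≤-reflexive (length-map (_- x) (filter (x ∈?_) M))) (length-filter (x ∈?_) M)

-- Missing sets all of whose vertices have degree at most one are pairwise disjoint.
degree≤1⇒length*d≤∣V∣ : ∀ {V : Subset n} {d} M → SubsetsOfSize V d M → (∀ {y} → y ∈ V → degree M y ≤ 1) →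
  length M * d ≤ ∣ V ∣
degree≤1⇒length*d≤∣V∣ [] _ _ = z≤n
degree≤1⇒length*d≤∣V∣ {V = V} {d} (G ∷ M) sized degree≤1 = begin
  d + length M * d   ≤⟨ +-monoʳ-≤ d (degree≤1⇒length*d≤∣V∣ M sizedRest degree≤1Rest) ⟩
  d + ∣ V ─ G ∣      ≡⟨ +-comm d _ ⟩
  ∣ V ─ G ∣ + d      ≡⟨ cong (∣ V ─ G ∣ +_) (proj₂ (sized (here refl))) ⟨
  ∣ V ─ G ∣ + ∣ G ∣  ≡⟨ ∣p─q∣+∣q∣≡∣p∣ V G G⊆V ⟩
  ∣ V ∣              ∎
  where
  open ≤-Reasoning
  G⊆V : G ⊆ V
  G⊆V = proj₁ (sized (here refl))
  degreeRest≡0 : ∀ {y} → y ∈ G → degree M y ≡ 0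
  degreeRest≡0 y∈G = n≤0⇒n≡0 (≤-pred (subst (_≤ 1) (degree-∷ M y∈G) (degree≤1 (G⊆V y∈G))))
  sizedRest : SubsetsOfSize (V ─ G) d M
  sizedRest {K} K∈M = let K⊆V , ∣K∣≡d = sized (there K∈M) in
    (λ {z} z∈K → x∈p∧x∉q⇒x∈p─q (K⊆V z∈K) λ z∈G →
       contradiction (subst (0 <_) (degreeRest≡0 z∈G) (∈-length (∈-filter⁺ (z ∈?_) K∈M z∈K))) n≮0) ,
    ∣K∣≡d
  degree≤1Rest : ∀ {y} → y ∈ V ─ G → degree M y ≤ 1
  degree≤1Rest {y} y∈ = ≤-trans (degree-∷-≤ G M y) (degree≤1 (proj₁ (x∈p─q⁻ V G y∈)))

-- |M| ≤ 2c - 1, read as M = [] when c = 0.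
FewMissing : ℕ → List (Subset n) → Set
FewMissing c M = M ≡ [] ⊎ suc (length M) ≤ 2 * c

fewMissing⁺ : ∀ {c} {M : List (Subset n)} → (0 < length M → suc (length M) ≤ 2 * c) → FewMissing c M
fewMissing⁺ {M = []} _ = inj₁ refl
fewMissing⁺ {M = _ ∷ _} bound = inj₂ (bound z<s)

fewMissing⁻ : ∀ {c} {M : List (Subset n)} {G} → G ∈ₗ M → FewMissing c M → suc (length M) ≤ 2 * c
fewMissing⁻ () (inj₁ refl)
fewMissing⁻ _ (inj₂ few) = few

fewMissing-link : ∀ {c} {M : List (Subset n)} x → FewMissing c M → FewMissing c (linkMissing M x)
fewMissing-link x (inj₁ refl) = inj₁ refl
fewMissing-link {M = M} x (inj₂ few) = inj₂ (≤-trans (s≤s (length-linkMissing≤ M x)) few)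

2≤t⇒1+t+m≤2[1+c]⇒1+m≤2c : ∀ {t m c} → 2 ≤ t → suc (t + m) ≤ 2 * suc c → suc m ≤ 2 * c
2≤t⇒1+t+m≤2[1+c]⇒1+m≤2c {t} {m} {c} 2≤t bound =
  +-cancelˡ-≤ 2 (suc m) (2 * c) (≤-trans (s≤s (+-monoˡ-≤ m 2≤t)) (subst (suc (t + m) ≤_) (*-suc 2 c) bound))

1+c≤t⇒1+c≤m⇒1+t+m≰2[1+c] : ∀ {t m c} → suc c ≤ t → suc c ≤ m → ¬ suc (t + m) ≤ 2 * suc c
1+c≤t⇒1+c≤m⇒1+t+m≰2[1+c] {t} {m} {c} 1+c≤t 1+c≤m bound = <-irrefl refl (begin-strict
  suc c + suc c       ≤⟨ +-mono-≤ 1+c≤t 1+c≤m ⟩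
  t + m               <⟨ bound ⟩
  2 * suc c           ≡⟨ cong (suc c +_) (+-identityʳ (suc c)) ⟩
  suc c + suc c       ∎)
  where open ≤-Reasoning

2≤e⇒[1+m]e≤1+c+e⇒0<m⇒1+m≤2c : ∀ {e m c} → 2 ≤ e → suc m * e ≤ suc c + e → 0 < m → suc m ≤ 2 * c
2≤e⇒[1+m]e≤1+c+e⇒0<m⇒1+m≤2c {e} {m} {c} 2≤e bound 0<m = begin
  suc m    ≤⟨ s≤s m≤c ⟩
  suc c    ≡⟨ +-comm 1 c ⟩
  c + 1    ≤⟨ +-monoʳ-≤ c (≤-trans 0<m m≤c) ⟩
  c + c    ≡⟨ cong (c +_) (+-identityʳ c) ⟨
  2 * c    ∎
  where
  open ≤-Reasoning
  m*e≤1+c : m * e ≤ suc c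
  m*e≤1+c = +-cancelˡ-≤ e (m * e) (suc c) (subst (e + m * e ≤_) (+-comm (suc c) e) bound)
  m≤c : m ≤ c
  m≤c = ≤-pred (begin
    1 + m          ≤⟨ +-monoˡ-≤ m 0<m ⟩
    m + m          ≡⟨ cong (m +_) (+-identityʳ m) ⟨
    2 * m          ≡⟨ *-comm 2 m ⟩
    m * 2          ≤⟨ *-monoʳ-≤ m 2≤e ⟩
    m * e          ≤⟨ m*e≤1+c ⟩
    suc c          ∎)

-- The induction step

module Counting {c d : ℕ} {V : Subset n} {M : List (Subset n)}
  (∣V∣≡ : ∣ V ∣ ≡ suc c + (2 + d)) (sized : SubsetsOfSize V (2 + d) M) (few : FewMissing (suc c) M) where

  fewMissing-split : ∀ {G} v → G ∈ₗ M → suc (degree M v + length (delMissing M v)) ≤ 2 * suc c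
  fewMissing-split v G∈M =
    subst (λ k → suc k ≤ 2 * suc c) (sym (degree+length-delMissing M v)) (fewMissing⁻ {c = suc c} G∈M few)

  -- Exchanging two different vertices of a facet H for v gives two missing sets through v.
  unused⇒fewMissing : ∀ {v H} → (∀ {K} → Generator V (2 + d) M K → v ∉ K) → v ∈ V →
    Generator V (2 + d) M H → FewMissing c (delMissing M v)
  unused⇒fewMissing {v} {H} unused v∈V g with generator-nonempty g
  ... | a , a∈H with other-element a∈H (subst (1 <_) (sym (card g)) (s≤s z<s))
  ... | b , b∈H , b≢a =
    inj₂ (2≤t⇒1+t+m≤2[1+c]⇒1+m≤2c 2≤degree (fewMissing-split v (exchange-missing a∈H)))
    where
    v∉H : v ∉ H
    v∉H = unused g
    exchange-missing : ∀ {w} → w ∈ H → exchange H w v ∈ₗ M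
    exchange-missing w∈H = ¬generator⇒missing (exchange-⊆ (⊆V g) v∈V) (trans (∣exchange∣ w∈H v∉H) (card g))
      λ g′ → unused g′ (y∈exchange H _ v)
    through-v : ∀ {w} → w ∈ H → exchange H w v ∈ₗ filter (v ∈?_) M
    through-v w∈H = ∈-filter⁺ (v ∈?_) (exchange-missing w∈H) (y∈exchange H _ v)
    2≤degree : 2 ≤ degree M v
    2≤degree = distinct⇒2≤length (through-v a∈H) (through-v b∈H) λ eq →
      x∉exchange (λ { refl → v∉H b∈H }) (subst (b ∈_) (sym eq) (z∈exchange b∈H b≢a))

  module _ {x : Fin n} (maximal : ∀ {y} → y ∈ V → degree M y ≤ degree M x) where

    -- If the c + 1 exchanges of x in K were all missing, they would put c + 1 missing sets through
    -- any other vertex z of K, hence through x, and c + 1 further ones avoiding x.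
    maxDegree⇒shedding : Shedding V (2 + d) M x
    maxDegree⇒shedding {K} gK x∈K
      with Finₚ.any? (λ y → ¬? (y ∈? K) ×-dec generator? V (2 + d) M (exchange K x y))
    ... | yes found = found
    ... | no none with other-element x∈K (subst (1 <_) (sym (card gK)) (s≤s z<s))
    ... | z , z∈K , z≢x = contradiction (fewMissing-split x (exchange-missing (proj₂ w∈W)))
      (1+c≤t⇒1+c≤m⇒1+t+m≰2[1+c] (≤-trans (count through-z) (maximal (⊆V gK z∈K))) (count avoiding-x))
      where
      W : Subset n
      W = V ─ K
      ∣W∣≡ : ∣ W ∣ ≡ suc c
      ∣W∣≡ = +-cancelʳ-≡ (2 + d) ∣ W ∣ (suc c)
        (trans (cong (∣ W ∣ +_) (sym (card gK))) (trans (∣p─q∣+∣q∣≡∣p∣ V K (⊆V gK)) ∣V∣≡))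
      w∈W : Nonempty W
      w∈W = 0<∣p∣⇒Nonempty W (subst (0 <_) (sym ∣W∣≡) z<s)
      exchange-missing : ∀ {y} → y ∈ W → exchange K x y ∈ₗ M
      exchange-missing y∈W = let y∈V , y∉K = x∈p─q⁻ V K y∈W in
        ¬generator⇒missing (exchange-⊆ (⊆V gK) y∈V) (trans (∣exchange∣ x∈K y∉K) (card gK))
          λ g → none (_ , y∉K , g)
      count : ∀ {xs} → (∀ {y} → y ∈ W → exchange K x y ∈ₗ xs) → suc c ≤ length xs
      count {xs} into = subst (_≤ length xs) ∣W∣≡ (injectiveOn⇒∣W∣≤length W (exchange K x) xs
        (λ y∈W _ → exchange-injective (proj₂ (x∈p─q⁻ V K y∈W))) into)
      through-z : ∀ {y} → y ∈ W → exchange K x y ∈ₗ filter (z ∈?_) M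
      through-z y∈W = ∈-filter⁺ (z ∈?_) (exchange-missing y∈W) (z∈exchange z∈K z≢x)
      avoiding-x : ∀ {y} → y ∈ W → exchange K x y ∈ₗ delMissing M x
      avoiding-x y∈W = ∈-filter⁺ (∁? (x ∈?_)) (exchange-missing y∈W)
        (x∉exchange λ { refl → proj₂ (x∈p─q⁻ V K y∈W) x∈K })

    missing⇒0<degree : ∀ {G} → G ∈ₗ M → 0 < degree M x
    missing⇒0<degree {G} G∈M =
      let G⊆V , ∣G∣≡ = sized G∈M
          w , w∈G = 0<∣p∣⇒Nonempty G (subst (0 <_) (sym ∣G∣≡) z<s)
      in ≤-trans (∈-length (∈-filter⁺ (w ∈?_) G∈M w∈G)) (maximal (G⊆V w∈G))

    -- Either x lies in two missing sets, or all degrees are at most one and the missing sets are disjoint.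
    maxDegree⇒fewMissing-del : FewMissing c (delMissing M x)
    maxDegree⇒fewMissing-del = fewMissing⁺ {c = c} λ 0<m →
      bound (proj₁ (∈-filter⁻ (∁? (x ∈?_)) (proj₂ (0<length⇒∈ 0<m)))) 0<m
      where
      bound : ∀ {G} → G ∈ₗ M → 0 < length (delMissing M x) → suc (length (delMissing M x)) ≤ 2 * c
      bound G∈M 0<m with 2 ≤? degree M x
      ... | yes 2≤degree = 2≤t⇒1+t+m≤2[1+c]⇒1+m≤2c 2≤degree (fewMissing-split x G∈M)
      ... | no 2≰degree = 2≤e⇒[1+m]e≤1+c+e⇒0<m⇒1+m≤2c (s≤s (s≤s z≤n)) disjoint 0<m
        where
        degree≤1 : degree M x ≤ 1
        degree≤1 = ≤-pred (≰⇒> 2≰degree)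
        degree≡1 : degree M x ≡ 1
        degree≡1 = ≤-antisym degree≤1 (missing⇒0<degree G∈M)
        disjoint : suc (length (delMissing M x)) * (2 + d) ≤ suc c + (2 + d)
        disjoint = subst₂ (λ k l → k * (2 + d) ≤ l)
          (trans (sym (degree+length-delMissing M x)) (cong (_+ length (delMissing M x)) degree≡1)) ∣V∣≡
          (degree≤1⇒length*d≤∣V∣ M sized (λ y∈V → ≤-trans (maximal y∈V) degree≤1))

VDWhenFewMissing : ℕ → ℕ → ℕ → Set
VDWhenFewMissing n c d = ∀ {Δ : Family n} {V M} → ∣ V ∣ ≡ c + d → Presentation Δ V d M → FewMissing c M →
  ∃ (Generator V d M) → VertexDecomposable Δ

module Step {c d : ℕ} (ih-codim : VDWhenFewMissing n c (2 + d)) (ih-dim : VDWhenFewMissing n (suc c) (1 + d))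
  {Δ : Family n} {V : Subset n} {M : List (Subset n)}
  (∣V∣≡ : ∣ V ∣ ≡ suc c + (2 + d)) (P : Presentation Δ V (2 + d) M) (few : FewMissing (suc c) M) where

  open Counting ∣V∣≡ (missing-sized P) few

  discard-unused : ∀ {v H} → (∀ {K} → Generator V (2 + d) M K → v ∉ K) → v ∈ V → Generator V (2 + d) M H →
    VertexDecomposable Δ
  discard-unused unused v∈V g = ih-codim (x∈p⇒∣p-x∣≡k V v∈V ∣V∣≡) (unused-presentation unused P)
    (unused⇒fewMissing unused v∈V g) (_ , generator-del g (unused g))

  shed-maxDegree : ∀ {u Hu} → (∀ {y} → y ∈ V → degree M y ≤ degree M u) → u ∈ V →
    Generator V (2 + d) M Hu → u ∈ Hu → VertexDecomposable Δ
  shed-maxDegree {u} {Hu} maximal u∈V gu u∈Hu with maxDegree⇒shedding maximal gu u∈Hu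
  ... | w , w∉Hu , gw = shedding⇒vd P (maxDegree⇒shedding maximal) (Hu , gu , u∈Hu)
    (ih-dim (trans ∣V-u∣≡ (+-suc c (suc d))) (link-presentation u∈V P) (fewMissing-link {c = suc c} u few)
      (Hu - u , generator-link gu u∈Hu))
    (ih-codim ∣V-u∣≡ (del-presentation (maxDegree⇒shedding maximal) P) (maxDegree⇒fewMissing-del maximal)
      (exchange Hu u w , generator-del gw (x∉exchange λ { refl → w∉Hu u∈Hu })))
    where
    ∣V-u∣≡ : ∣ V - u ∣ ≡ c + (2 + d)
    ∣V-u∣≡ = x∈p⇒∣p-x∣≡k V u∈V ∣V∣≡

  inFacet? : ∀ v → Dec (∃ λ K → Generator V (2 + d) M K × v ∈ K)
  inFacet? v = anySubset? (λ K → generator? V (2 + d) M K ×-dec (v ∈? K))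

  vertexDecomposable : ∃ (Generator V (2 + d) M) → VertexDecomposable Δ
  vertexDecomposable (H , g) with Finₚ.any? (λ v → (v ∈? V) ×-dec ¬? (inFacet? v))
  ... | yes (v , v∈V , unused) = discard-unused (λ gK v∈K → unused (_ , gK , v∈K)) v∈V g
  ... | no allUsed with argmaxOn (degree M) V (_ , ⊆V g (proj₂ (generator-nonempty g)))
  ... | u , u∈V , maximal with decidable-stable (inFacet? u) (λ none → allUsed (u , u∈V , none))
  ... | Hu , gu , u∈Hu = shed-maxDegree maximal u∈V gu u∈Hu

vd-step : ∀ {c d} → VDWhenFewMissing n c (2 + d) → VDWhenFewMissing n (suc c) (1 + d) →
  VDWhenFewMissing n (suc c) (2 + d)
vd-step ih-codim ih-dim ∣V∣≡ P few = Step.vertexDecomposable ih-codim ih-dim ∣V∣≡ P few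

fewMissing⇒vd : ∀ c d → VDWhenFewMissing n c d
fewMissing⇒vd c zero _ P _ gen = empty-vd P gen
fewMissing⇒vd c (suc zero) ∣V∣≡ P _ gen = points-vd c ∣V∣≡ P gen
fewMissing⇒vd zero (suc (suc d)) ∣V∣≡ P _ gen = simplex-vd P ∣V∣≡ gen
fewMissing⇒vd (suc c) (suc (suc d)) = vd-step (fewMissing⇒vd c (suc (suc d))) (fewMissing⇒vd (suc c) (suc d))

-- Pure complexes

subsetsOfSize : ∀ n d → length (filter (λ H → ∣ H ∣ ≟ d) (allSubsets n)) ≡ n C d
subsetsOfSize zero zero = refl
subsetsOfSize zero (suc d) = refl
subsetsOfSize (suc n) d = begin
  length (filter (sized? d) (map (false ∷_) A ++ map (true ∷_) A))
    ≡⟨ cong length (filter-++ (sized? d) (map (false ∷_) A) (map (true ∷_) A)) ⟩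
  length (filter (sized? d) (map (false ∷_) A) ++ filter (sized? d) (map (true ∷_) A))
    ≡⟨ length-++ (filter (sized? d) (map (false ∷_) A)) ⟩
  length (filter (sized? d) (map (false ∷_) A)) + length (filter (sized? d) (map (true ∷_) A))
    ≡⟨ cong (_+ length (filter (sized? d) (map (true ∷_) A)))
         (trans (length-filter-map (sized? d) (sized? d) (false ∷_) A λ _ → refl) (subsetsOfSize n d)) ⟩
  n C d + length (filter (sized? d) (map (true ∷_) A))
    ≡⟨ pascal d ⟩
  suc n C d ∎
  where
  open ≡-Reasoning
  A : List (Subset n)
  A = allSubsets n
  sized? : ∀ {m} d → Decidable (λ (H : Subset m) → ∣ H ∣ ≡ d)
  sized? d H = ∣ H ∣ ≟ d
  pascal : ∀ d → n C d + length (filter (sized? d) (map (true ∷_) A)) ≡ suc n C d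
  pascal zero =
    cong (n C 0 +_) (cong length (filter-none (sized? 0) (map⁺ (All.universal (λ _ ()) A))))
  pascal (suc d) = begin
    n C suc d + length (filter (sized? (suc d)) (map (true ∷_) A))
      ≡⟨ cong (n C suc d +_) (trans (length-filter-map (sized? (suc d)) (sized? d) (true ∷_) A λ _ → refl)
                                     (subsetsOfSize n d)) ⟩
    n C suc d + n C d     ≡⟨ +-comm (n C suc d) (n C d) ⟩
    n C d + n C suc d     ≡⟨ ℕC.nCk+nC[k+1]≡[n+1]C[k+1] n d ⟩
    suc n C suc d         ∎

module PureComplex {n} (Δ : Family n) (sc : IsSimplicialComplex Δ) (pure : IsPure Δ) where

  d : ℕ
  d = maxFaceSize Δ

  face⇒∣∣≤d : ∀ {G} → IsFace Δ G → ∣ G ∣ ≤ d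
  face⇒∣∣≤d {G} ΔG = foldr-⊔-upper ∣_∣ (∈-filter⁺ (λ F → Δ F ≟ᵇ true) (∈-allSubsets G) ΔG)

  largestFace : ∃ λ F → IsFace Δ F × ∣ F ∣ ≡ d
  largestFace =
    let F , F∈ , ∣F∣≡d = foldr-⊔-attained ∣_∣ (∈-filter⁺ (λ F → Δ F ≟ᵇ true) (∈-allSubsets ∅) (proj₁ sc))
    in F , proj₂ (∈-filter⁻ (λ F → Δ F ≟ᵇ true) {xs = allSubsets n} F∈) , ∣F∣≡d

  face-of-size-d⇒facet : ∀ {F} → IsFace Δ F → ∣ F ∣ ≡ d → IsFacet Δ F
  face-of-size-d⇒facet {F} ΔF ∣F∣≡d = isFacet⁺ ΔF λ {G} ΔG F⊆G → decidable-stable (F ≟ˢ G) λ F≢G →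
    <-irrefl ∣F∣≡d (<-≤-trans (p⊆q⇒p≢q⇒∣p∣<∣q∣ F⊆G F≢G) (face⇒∣∣≤d ΔG))

  facet-card : ∀ {F} → IsFacet Δ F → ∣ F ∣ ≡ d
  facet-card {F} facet = let F₀ , ΔF₀ , ∣F₀∣≡d = largestFace in
    trans (pure F F₀ facet (face-of-size-d⇒facet ΔF₀ ∣F₀∣≡d)) ∣F₀∣≡d

  d≤n : d ≤ n
  d≤n = let F₀ , _ , ∣F₀∣≡d = largestFace in subst (_≤ n) ∣F₀∣≡d (∣p∣≤n F₀)

  NonFace : Subset n → Set
  NonFace H = ∣ H ∣ ≡ d × Δ H ≡ false

  nonFace? : Decidable NonFace
  nonFace? H = (∣ H ∣ ≟ d) ×-dec (Δ H ≟ᵇ false)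

  missing : List (Subset n)
  missing = filter nonFace? (allSubsets n)

  presentation : Presentation Δ ⊤ d missing
  presentation = record
    { face⇒covered = λ ΔG → let F , facet , G⊆F = face⊆facet Δ ΔG in
        F , generator ⊆⊤ (facet-card facet) (nonMissing (proj₁ (isFacet⁻ {Δ = Δ} facet))) , G⊆F
    ; covered⇒face = λ {G} (H , g , G⊆H) → proj₂ (proj₂ sc) H G G⊆H
        (¬-not λ ΔH≡false → ∉M g (∈-filter⁺ nonFace? (∈-allSubsets H) (card g , ΔH≡false)))
    ; missing-sized = λ G∈ → ⊆⊤ , proj₁ (proj₂ (∈-filter⁻ nonFace? {xs = allSubsets n} G∈))
    }
    where
    nonMissing : ∀ {F} → IsFace Δ F → F ∉ₗ missing
    nonMissing ΔF F∈ =
      contradiction (trans (sym ΔF) (proj₂ (proj₂ (∈-filter⁻ nonFace? {xs = allSubsets n} F∈)))) λ ()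

  facets+missing≡nCd : numFacets Δ + length missing ≡ n C d
  facets+missing≡nCd = trans
    (length-filter-partition (λ F → isFacetᵇ Δ F ≟ᵇ true) nonFace? (λ H → ∣ H ∣ ≟ d) (allSubsets n)
      facetOrNonFace facet-card proj₁ (λ facet (_ , ΔH≡false) → contradiction
        (trans (sym (proj₁ (isFacet⁻ {Δ = Δ} facet))) ΔH≡false) λ ()))
    (subsetsOfSize n d)
    where
    facetOrNonFace : ∀ {H} → ∣ H ∣ ≡ d → IsFacet Δ H ⊎ NonFace H
    facetOrNonFace {H} ∣H∣≡d with Δ H ≟ᵇ true
    ... | yes ΔH = inj₁ (face-of-size-d⇒facet ΔH ∣H∣≡d)
    ... | no ¬ΔH = inj₂ (∣H∣≡d , ¬-not ¬ΔH)

  ∣⊤∣≡codim+d : ∣ ⊤ {n} ∣ ≡ codim Δ + d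
  ∣⊤∣≡codim+d = trans (∣⊤∣≡n n) (sym (m∸n+n≡m d≤n))

  largestFacet : ∃ (Generator ⊤ d missing)
  largestFacet = let F₀ , ΔF₀ , ∣F₀∣≡d = largestFace in
    F₀ , facet⇒generator presentation (face-of-size-d⇒facet ΔF₀ ∣F₀∣≡d)

  fewMissing : n C codim Δ + 1 ≤ numFacets Δ + 2 * codim Δ → FewMissing (codim Δ) missing
  fewMissing bound = inj₂ (+-cancelˡ-≤ (numFacets Δ) _ _ (subst (_≤ numFacets Δ + 2 * codim Δ) counted bound))
    where
    open ≡-Reasoning
    counted : n C codim Δ + 1 ≡ numFacets Δ + suc (length missing)
    counted = begin
      n C (n ∸ d) + 1                     ≡⟨ cong (_+ 1) (ℕC.nCk≡nC[n∸k] d≤n) ⟨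
      n C d + 1                           ≡⟨ cong (_+ 1) facets+missing≡nCd ⟨
      numFacets Δ + length missing + 1    ≡⟨ +-assoc (numFacets Δ) (length missing) 1 ⟩
      numFacets Δ + (length missing + 1)  ≡⟨ cong (numFacets Δ +_) (+-comm (length missing) 1) ⟩
      numFacets Δ + suc (length missing)  ∎

theorem1p1 : (n : ℕ) (Δ : Family n) → IsSimplicialComplex Δ → IsPure Δ →
    (n C codim Δ) + 1 ≤ numFacets Δ + 2 * codim Δ →
    VertexDecomposable Δ
theorem1p1 n Δ sc pure bound =
  fewMissing⇒vd (codim Δ) d ∣⊤∣≡codim+d presentation (fewMissing bound) largestFacet
  where open PureComplex Δ sc pure
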